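{- For every integer $i\geq 1$ there exists a tanglegram $\mathcal{T}$ of size $2^i$ whose tanglegram crossing number is exactly $$\operatorname{crt}(\mathcal{T})=\frac{1}{2}\binom{2^i}{2}-i\,2^{i-2}.$$
   Context: A rooted binary tree is a rooted tree in which every vertex has either two children or none (vertices with no children are leaves; a single vertex is allowed). A tanglegram $\mathcal{T}=(L,R,\sigma)$ consists of two rooted binary trees $L,R$ with the same number $n$ of leaves and a perfect matching $\sigma$ between the leaf set of $L$ and the leaf set of $R$; $n$ is the size of $\mathcal{T}$. A layout of $\mathcal{T}$ is obtained by choosing, at every internal vertex of $L$ and of $R$, a left/right order of its two children; this determines a top-to-bottom linear order of the leaves of $L$ (drawn on the line $x=0$, with $L$ drawn as a plane tree in $x\le 0$) and of the leaves of $R$ (on the line $x=1$, with $R$ drawn as a plane tree in $x\ge 1$), and the matching edges are straight segments between the two lines. Two matching edges cross in the layout iff their endpoints appear in opposite relative orders on the two lines. The crossing number of a layout is the number of crossing pairs of matching edges, and the tanglegram crossing number $\operatorname{crt}(\mathcal{T})$ is the minimum crossing number over all layouts of $\mathcal{T}$. -}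

module Defs where

open import Data.Nat using (ℕ; zero; suc; _+_; _<ᵇ_)
open import Data.Bool using (Bool; true; false; if_then_else_)
open import Data.Fin using (Fin; zero; suc; _↑ˡ_; _↑ʳ_; toℕ; _≟_)
open import Data.List using (List; []; _∷_; _++_; map; [_])
open import Data.Product using (Σ; _×_; _,_; ∃₂)
open import Function.Bundles using (_↔_; Inverse)
open import Relation.Nullary using (yes; no)
open import Data.Nat using (_≤_)
open import Relation.Binary.PropositionalEquality using (_≡_)

data Tree : Set where
  leaf : Tree
  node : Tree → Tree → Tree

size : Tree → ℕ
size leaf = 1
size (node l r) = size l + size r

-- Leaves of t are identified with Fin (size t) (canonical left-to-right numbering
-- of the unlayouted tree: leaves of the first subtree, then of the second).

-- A layout: a left/right order of the two children at every internal vertex.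
data Layout : Tree → Set where
  leafL : Layout leaf
  nodeL : {l r : Tree} → Bool → Layout l → Layout r → Layout (node l r)

order : (t : Tree) → Layout t → List (Fin (size t))
order leaf leafL = [ zero ]
order (node l r) (nodeL b ll lr) =
  if b then map (_↑ˡ size r) (order l ll) ++ map (size l ↑ʳ_) (order r lr)
       else map (size l ↑ʳ_) (order r lr) ++ map (_↑ˡ size r) (order l ll)

position : {m : ℕ} → List (Fin m) → Fin m → ℕ
position [] x = zero
position (y ∷ ys) x with y ≟ x
... | yes _ = zero
... | no _ = suc (position ys x)

countLess : ℕ → List ℕ → ℕ
countLess x [] = 0
countLess x (y ∷ ys) = (if y <ᵇ x then 1 else 0) + countLess x ys

inversions : List ℕ → ℕ
inversions [] = 0
inversions (x ∷ xs) = countLess x xs + inversions xs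

record Tanglegram : Set where
  constructor tanglegram
  field
    L : Tree
    R : Tree
    σ : Fin (size L) ↔ Fin (size R)

open Tanglegram public

tsize : Tanglegram → ℕ
tsize T = size (L T)

-- Crossing number of a layout: the matching edges listed in the top-to-bottom
-- order of the left leaves; two edges cross iff their right endpoints appear in
-- the opposite order, i.e. the pairs crossing are the inversions of the sequence
-- of right-positions.
crossings : (T : Tanglegram) → Layout (L T) → Layout (R T) → ℕ
crossings T lL lR =
  inversions (map (λ a → position (order (R T) lR) (Inverse.to (σ T) a))
                  (order (L T) lL))

IsCrt : Tanglegram → ℕ → Set
IsCrt T k =
  (Σ (Layout (L T)) λ lL → Σ (Layout (R T)) λ lR → crossings T lL lR ≡ k)
  × ((lL : Layout (L T)) (lR : Layout (R T)) → k ≤ crossings T lL lR)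

module Submission where

-- Double a tanglegram T = (t, s, σ): replace every leaf x of t by a cherry whose two leaves are
-- matched to the copies of σ x in the two halves of the right tree node s s.  In a layout, the
-- edges into the upper half and those into the lower half are each a layout of T.  For two
-- cherries x above y, of the two pairs of their edges that go to different halves exactly one
-- crosses (x to the lower half against y to the upper half), and the two edges of a cherry cross
-- iff it is drawn the opposite way to the halves.  Hence every layout has at least 2 crt(T) + C(n,2)
-- crossings, with equality when both halves use an optimal layout and no cherry is turned over.
-- Iterating from the one-leaf tanglegram gives crt = 2 crt + C(2^i,2), whose solution is the
-- stated formula.

open import Defs
open import Data.Nat using (ℕ; zero; suc; _+_; _*_; _^_; _<_; _≤_; _<ᵇ_; z≤n; s≤s)
open import Data.Nat.Properties hiding (_≟_)
open import Data.Nat.Combinatorics using (_C_; nC1≡n; nCk+nC[k+1]≡[n+1]C[k+1])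
open import Data.Nat.ListAction using (sum)
open import Data.Nat.Solver using (module +-*-Solver)
open +-*-Solver using (solve; _:=_; _:+_; _:*_; con)
open import Data.Bool using (Bool; true; false; if_then_else_)
open import Data.Fin using (Fin; zero; suc; _↑ˡ_; _↑ʳ_; splitAt; join; _≟_)
open import Data.Fin.Properties
  using (splitAt-↑ˡ; splitAt-↑ʳ; join-splitAt; ↑ˡ-injective; ↑ʳ-injective; +↔⊎)
open import Data.Sum using (_⊎_; inj₁; inj₂; [_,_]′) renaming (map to ⊎-map)
open import Data.Sum.Function.Propositional using (_⊎-↔_)
open import Data.List using (List; []; _∷_; _++_; map; concat; concatMap; length)
open import Data.List.Properties
  using (map-++; map-∘; length-++; length-map; concat-++; concatMap-cong; concatMap-map)
open import Data.List.Membership.Propositional using (_∈_)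
open import Data.List.Membership.Propositional.Properties using (∈-++⁺ˡ; ∈-++⁺ʳ; ∈-map⁺)
open import Data.List.Relation.Unary.Any using (here; there)
open import Data.Product using (Σ; _×_; _,_)
open import Data.Empty using (⊥-elim)
open import Function using (_∘_)
open import Function.Bundles using (_↔_; Inverse; mk↔ₛ′)
open import Function.Definitions using (Injective)
open import Function.Properties.Inverse using (↔-refl; ↔-sym; ↔-trans)
open import Relation.Binary.PropositionalEquality
open import Relation.Nullary using (yes; no; ¬_)

position-map : ∀ {m k} (f : Fin m → Fin k) → Injective _≡_ _≡_ f →
               ∀ xs x → position (map f xs) (f x) ≡ position xs x
position-map f f-inj [] x = refl
position-map f f-inj (y ∷ ys) x with y ≟ x | f y ≟ f x
... | yes _   | yes _   = refl
... | yes y≡x | no fy≢fx = ⊥-elim (fy≢fx (cong f y≡x))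
... | no y≢x  | yes fy≡fx = ⊥-elim (y≢x (f-inj fy≡fx))
... | no _    | no _    = cong suc (position-map f f-inj ys x)

position-++ˡ : ∀ {m} (xs ys : List (Fin m)) {x} → x ∈ xs → position (xs ++ ys) x ≡ position xs x
position-++ˡ (y ∷ xs) ys {x} x∈ with y ≟ x
... | yes _ = refl
... | no y≢x with x∈
...   | here x≡y = ⊥-elim (y≢x (sym x≡y))
...   | there x∈xs = cong suc (position-++ˡ xs ys x∈xs)

position-++ʳ : ∀ {m} (xs ys : List (Fin m)) {x} → ¬ x ∈ xs →
               position (xs ++ ys) x ≡ length xs + position ys x
position-++ʳ [] ys x∉ = refl
position-++ʳ (y ∷ xs) ys {x} x∉ with y ≟ x
... | yes y≡x = ⊥-elim (x∉ (here (sym y≡x)))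
... | no _ = cong suc (position-++ʳ xs ys (x∉ ∘ there))

position<length : ∀ {m} (xs : List (Fin m)) {x} → x ∈ xs → position xs x < length xs
position<length (y ∷ xs) {x} x∈ with y ≟ x
... | yes _ = s≤s z≤n
... | no y≢x with x∈
...   | here x≡y = ⊥-elim (y≢x (sym x≡y))
...   | there x∈xs = s≤s (position<length xs x∈xs)

↑-elim : ∀ m n (P : Fin (m + n) → Set) → (∀ u → P (u ↑ˡ n)) → (∀ v → P (m ↑ʳ v)) → ∀ x → P x
↑-elim m n P left right x = subst P (join-splitAt m n x) (by-side (splitAt m x))
  where
  by-side : (y : Fin m ⊎ Fin n) → P (join m n y)
  by-side (inj₁ u) = left u
  by-side (inj₂ v) = right v

↑ˡ≢↑ʳ : ∀ m n (u : Fin m) (v : Fin n) → u ↑ˡ n ≢ m ↑ʳ v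
↑ˡ≢↑ʳ m n u v eq with trans (sym (splitAt-↑ˡ m u n)) (trans (cong (splitAt m) eq) (splitAt-↑ʳ m n v))
... | ()

↑ʳ∉map↑ˡ : ∀ m n (v : Fin n) (us : List (Fin m)) → ¬ (m ↑ʳ v) ∈ map (_↑ˡ n) us
↑ʳ∉map↑ˡ m n v (u ∷ us) (here eq) = ↑ˡ≢↑ʳ m n u v (sym eq)
↑ʳ∉map↑ˡ m n v (u ∷ us) (there v∈) = ↑ʳ∉map↑ˡ m n v us v∈

↑ˡ∉map↑ʳ : ∀ m n (u : Fin m) (vs : List (Fin n)) → ¬ (u ↑ˡ n) ∈ map (m ↑ʳ_) vs
↑ˡ∉map↑ʳ m n u (v ∷ vs) (here eq) = ↑ˡ≢↑ʳ m n u v eq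
↑ˡ∉map↑ʳ m n u (v ∷ vs) (there u∈) = ↑ˡ∉map↑ʳ m n u vs u∈

length-order : ∀ t ρ → length (order t ρ) ≡ size t
length-order leaf leafL = refl
length-order (node l r) (nodeL true ρl ρr) =
  trans (length-++ (map (_↑ˡ size r) (order l ρl)))
        (cong₂ _+_ (trans (length-map _ (order l ρl)) (length-order l ρl))
                   (trans (length-map _ (order r ρr)) (length-order r ρr)))
length-order (node l r) (nodeL false ρl ρr) =
  trans (length-++ (map (size l ↑ʳ_) (order r ρr)))
        (trans (cong₂ _+_ (trans (length-map _ (order r ρr)) (length-order r ρr))
                          (trans (length-map _ (order l ρl)) (length-order l ρl)))
               (+-comm (size r) (size l)))

∈-order : ∀ t ρ x → x ∈ order t ρ
∈-order leaf leafL zero = here refl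
∈-order (node l r) (nodeL true ρl ρr) =
  ↑-elim (size l) (size r) _
    (λ u → ∈-++⁺ˡ (∈-map⁺ (_↑ˡ size r) (∈-order l ρl u)))
    (λ v → ∈-++⁺ʳ (map (_↑ˡ size r) (order l ρl)) (∈-map⁺ (size l ↑ʳ_) (∈-order r ρr v)))
∈-order (node l r) (nodeL false ρl ρr) =
  ↑-elim (size l) (size r) _
    (λ u → ∈-++⁺ʳ (map (size l ↑ʳ_) (order r ρr)) (∈-map⁺ (_↑ˡ size r) (∈-order l ρl u)))
    (λ v → ∈-++⁺ˡ (∈-map⁺ (size l ↑ʳ_) (∈-order r ρr v)))

position<size : ∀ t ρ x → position (order t ρ) x < size t
position<size t ρ x = subst (position (order t ρ) x <_) (length-order t ρ)
                            (position<length (order t ρ) (∈-order t ρ x))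

position-order-↑ˡ : ∀ l r b ρl ρr u →
  position (order (node l r) (nodeL b ρl ρr)) (u ↑ˡ size r) ≡
  (if b then 0 else size r) + position (order l ρl) u
position-order-↑ˡ l r true ρl ρr u =
  trans (position-++ˡ (map (_↑ˡ size r) (order l ρl)) _ (∈-map⁺ (_↑ˡ size r) (∈-order l ρl u)))
        (position-map (_↑ˡ size r) (↑ˡ-injective (size r) _ _) (order l ρl) u)
position-order-↑ˡ l r false ρl ρr u =
  trans (position-++ʳ (map (size l ↑ʳ_) (order r ρr)) _ (↑ˡ∉map↑ʳ (size l) (size r) u (order r ρr)))
        (cong₂ _+_ (trans (length-map _ (order r ρr)) (length-order r ρr))
                   (position-map (_↑ˡ size r) (↑ˡ-injective (size r) _ _) (order l ρl) u))

position-order-↑ʳ : ∀ l r b ρl ρr v →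
  position (order (node l r) (nodeL b ρl ρr)) (size l ↑ʳ v) ≡
  (if b then size l else 0) + position (order r ρr) v
position-order-↑ʳ l r true ρl ρr v =
  trans (position-++ʳ (map (_↑ˡ size r) (order l ρl)) _ (↑ʳ∉map↑ˡ (size l) (size r) v (order l ρl)))
        (cong₂ _+_ (trans (length-map _ (order l ρl)) (length-order l ρl))
                   (position-map (size l ↑ʳ_) (↑ʳ-injective (size l) _ _) (order r ρr) v))
position-order-↑ʳ l r false ρl ρr v =
  trans (position-++ˡ (map (size l ↑ʳ_) (order r ρr)) _ (∈-map⁺ (size l ↑ʳ_) (∈-order r ρr v)))
        (position-map (size l ↑ʳ_) (↑ʳ-injective (size l) _ _) (order r ρr) v)

triangle : ℕ → ℕ
triangle zero = 0
triangle (suc m) = m + triangle m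

triangle≡C2 : ∀ m → triangle m ≡ m C 2
triangle≡C2 zero = refl
triangle≡C2 (suc m) =
  trans (cong₂ _+_ (sym (nC1≡n m)) (triangle≡C2 m)) (nCk+nC[k+1]≡[n+1]C[k+1] m 1)

orient : {A : Set} → Bool → A → A → List A
orient o u v = if o then u ∷ v ∷ [] else v ∷ u ∷ []

Arrangement : {A : Set} → A → A → List A → Set
Arrangement u v w = w ≡ u ∷ v ∷ [] ⊎ w ≡ v ∷ u ∷ []

orient-arrangement : ∀ {A : Set} o {u v a b : A} → u ≡ a → v ≡ b → Arrangement a b (orient o u v)
orient-arrangement true refl refl = inj₁ refl
orient-arrangement false refl refl = inj₂ refl

orient-arrangement-swapped : ∀ {A : Set} o {u v a b : A} → u ≡ b → v ≡ a →
                             Arrangement a b (orient o u v)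
orient-arrangement-swapped true refl refl = inj₂ refl
orient-arrangement-swapped false refl refl = inj₁ refl

<ᵇ-true : ∀ {a b} → a < b → (a <ᵇ b) ≡ true
<ᵇ-true {zero} {suc b} _ = refl
<ᵇ-true {suc a} {suc b} (s≤s a<b) = <ᵇ-true a<b

<ᵇ-false : ∀ {a b} → b ≤ a → (a <ᵇ b) ≡ false
<ᵇ-false {a} {zero} _ = refl
<ᵇ-false {suc a} {suc b} (s≤s b≤a) = <ᵇ-false b≤a

+-<ᵇ-cancelˡ : ∀ N a b → (N + a <ᵇ N + b) ≡ (a <ᵇ b)
+-<ᵇ-cancelˡ zero a b = refl
+-<ᵇ-cancelˡ (suc N) a b = +-<ᵇ-cancelˡ N a b

inversions-ascending-pair : ∀ {u v} → u ≤ v → inversions (u ∷ v ∷ []) ≡ 0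
inversions-ascending-pair u≤v rewrite <ᵇ-false u≤v = refl

countLess-++ : ∀ c xs ys → countLess c (xs ++ ys) ≡ countLess c xs + countLess c ys
countLess-++ c [] ys = refl
countLess-++ c (y ∷ xs) ys =
  trans (cong ((if y <ᵇ c then 1 else 0) +_) (countLess-++ c xs ys))
        (sym (+-assoc (if y <ᵇ c then 1 else 0) _ _))

module _ {X : Set} (block : X → List ℕ) (a b : X → ℕ) (N : ℕ) (a<N : ∀ x → a x < N)
         (block-arrangement : ∀ x → Arrangement (a x) (N + b x) (block x)) where

  private
    high≮low : ∀ c x → c < N → (N + b x <ᵇ c) ≡ false
    high≮low c x c<N = <ᵇ-false (≤-trans (<⇒≤ c<N) (m≤m+n N (b x)))

    low<high : ∀ c x → (a x <ᵇ N + c) ≡ true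
    low<high c x = <ᵇ-true (≤-trans (a<N x) (m≤m+n N c))

    countLess-block-low : ∀ c x → c < N → countLess c (block x) ≡ (if a x <ᵇ c then 1 else 0)
    countLess-block-low c x c<N with block-arrangement x
    ... | inj₁ eq rewrite eq | high≮low c x c<N = +-identityʳ _
    ... | inj₂ eq rewrite eq | high≮low c x c<N = +-identityʳ _

    countLess-block-high : ∀ c x → countLess (N + c) (block x) ≡ 1 + (if b x <ᵇ c then 1 else 0)
    countLess-block-high c x with block-arrangement x
    ... | inj₁ eq rewrite eq | low<high c x | +-<ᵇ-cancelˡ N (b x) c = cong suc (+-identityʳ _)
    ... | inj₂ eq rewrite eq | low<high c x | +-<ᵇ-cancelˡ N (b x) c = +-comm _ 1

    countLess-low : ∀ c xs → c < N → countLess c (concatMap block xs) ≡ countLess c (map a xs)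
    countLess-low c [] c<N = refl
    countLess-low c (x ∷ xs) c<N =
      trans (countLess-++ c (block x) (concatMap block xs))
            (cong₂ _+_ (countLess-block-low c x c<N) (countLess-low c xs c<N))

    countLess-high : ∀ c xs →
      countLess (N + c) (concatMap block xs) ≡ length xs + countLess c (map b xs)
    countLess-high c [] = refl
    countLess-high c (x ∷ xs) =
      trans (countLess-++ (N + c) (block x) (concatMap block xs))
      (trans (cong₂ _+_ (countLess-block-high c x) (countLess-high c xs))
             (solve 3 (λ p q r → (con 1 :+ p) :+ (q :+ r) := (con 1 :+ q) :+ (p :+ r)) refl
                (if b x <ᵇ c then 1 else 0) (length xs) (countLess c (map b xs))))

  -- Within-block inversions are counted by the last summand; every low value of a later block
  -- is below every high value of an earlier one, which gives the triangle term.
  inversions-concatMap-blocks : ∀ xs → inversions (concatMap block xs) ≡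
    inversions (map a xs) + inversions (map b xs) + triangle (length xs) +
    sum (map (inversions ∘ block) xs)
  inversions-concatMap-blocks [] = refl
  inversions-concatMap-blocks (x ∷ xs) with block-arrangement x
  ... | inj₁ eq rewrite eq | high≮low (a x) x (a<N x)
          | countLess-low (a x) xs (a<N x) | countLess-high (b x) xs | inversions-concatMap-blocks xs =
    solve 7 (λ A IA B IB L T S → A :+ ((L :+ B) :+ (IA :+ IB :+ T :+ S))
                := (A :+ IA) :+ (B :+ IB) :+ (L :+ T) :+ S) refl
      (countLess (a x) (map a xs)) (inversions (map a xs)) (countLess (b x) (map b xs))
      (inversions (map b xs)) (length xs) (triangle (length xs)) (sum (map (inversions ∘ block) xs))
  ... | inj₂ eq rewrite eq | low<high (b x) x
          | countLess-low (a x) xs (a<N x) | countLess-high (b x) xs | inversions-concatMap-blocks xs =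
    solve 7 (λ A IA B IB L T S → (con 1 :+ (L :+ B)) :+ (A :+ (IA :+ IB :+ T :+ S))
                := (A :+ IA) :+ (B :+ IB) :+ (L :+ T) :+ (con 1 :+ S)) refl
      (countLess (a x) (map a xs)) (inversions (map a xs)) (countLess (b x) (map b xs))
      (inversions (map b xs)) (length xs) (triangle (length xs)) (sum (map (inversions ∘ block) xs))

sum-map-≡0 : ∀ {X : Set} (f : X → ℕ) xs → (∀ x → f x ≡ 0) → sum (map f xs) ≡ 0
sum-map-≡0 f [] f≡0 = refl
sum-map-≡0 f (x ∷ xs) f≡0 rewrite f≡0 x = sum-map-≡0 f xs f≡0

cherry : Tree → Tree
cherry leaf = node leaf leaf
cherry (node l r) = node (cherry l) (cherry r)

size-cherry : ∀ t → size (cherry t) ≡ size t + size t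
size-cherry leaf = refl
size-cherry (node l r) rewrite size-cherry l | size-cherry r =
  solve 2 (λ p q → (p :+ p) :+ (q :+ q) := (p :+ q) :+ (p :+ q)) refl (size l) (size r)

select : {A : Set} → Bool → A → A ⊎ A
select false = inj₁
select true = inj₂

map-select : ∀ {A B : Set} (f : A → B) c x → ⊎-map f f (select c x) ≡ select c (f x)
map-select f false x = refl
map-select f true x = refl

twin : (t : Tree) → Bool → Fin (size t) → Fin (size (cherry t))
twin leaf false zero = zero
twin leaf true zero = suc zero
twin (node l r) c x =
  [ (λ u → twin l c u ↑ˡ size (cherry r)) , (λ v → size (cherry l) ↑ʳ twin r c v) ]′ (splitAt (size l) x)

twins : (t : Tree) → Fin (size t) ⊎ Fin (size t) → Fin (size (cherry t))
twins t = [ twin t false , twin t true ]′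

untwin : (t : Tree) → Fin (size (cherry t)) → Fin (size t) ⊎ Fin (size t)
untwin leaf zero = inj₁ zero
untwin leaf (suc zero) = inj₂ zero
untwin (node l r) y =
  [ (λ u → ⊎-map (_↑ˡ size r) (_↑ˡ size r) (untwin l u))
  , (λ v → ⊎-map (size l ↑ʳ_) (size l ↑ʳ_) (untwin r v)) ]′ (splitAt (size (cherry l)) y)

twin-↑ˡ : ∀ l r c u → twin (node l r) c (u ↑ˡ size r) ≡ twin l c u ↑ˡ size (cherry r)
twin-↑ˡ l r c u rewrite splitAt-↑ˡ (size l) u (size r) = refl

twin-↑ʳ : ∀ l r c v → twin (node l r) c (size l ↑ʳ v) ≡ size (cherry l) ↑ʳ twin r c v
twin-↑ʳ l r c v rewrite splitAt-↑ʳ (size l) (size r) v = refl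

untwin-twin : ∀ t c x → untwin t (twin t c x) ≡ select c x
untwin-twin leaf false zero = refl
untwin-twin leaf true zero = refl
untwin-twin (node l r) c = ↑-elim (size l) (size r) _ left right
  where
  left : ∀ u → untwin (node l r) (twin (node l r) c (u ↑ˡ size r)) ≡ select c (u ↑ˡ size r)
  left u rewrite twin-↑ˡ l r c u | splitAt-↑ˡ (size (cherry l)) (twin l c u) (size (cherry r))
               | untwin-twin l c u = map-select (_↑ˡ size r) c u
  right : ∀ v → untwin (node l r) (twin (node l r) c (size l ↑ʳ v)) ≡ select c (size l ↑ʳ v)
  right v rewrite twin-↑ʳ l r c v | splitAt-↑ʳ (size (cherry l)) (size (cherry r)) (twin r c v)
                | untwin-twin r c v = map-select (size l ↑ʳ_) c v

untwin-twins : ∀ t z → untwin t (twins t z) ≡ z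
untwin-twins t (inj₁ x) = untwin-twin t false x
untwin-twins t (inj₂ x) = untwin-twin t true x

twins-map-↑ˡ : ∀ l r z → twins (node l r) (⊎-map (_↑ˡ size r) (_↑ˡ size r) z) ≡ twins l z ↑ˡ size (cherry r)
twins-map-↑ˡ l r (inj₁ x) = twin-↑ˡ l r false x
twins-map-↑ˡ l r (inj₂ x) = twin-↑ˡ l r true x

twins-map-↑ʳ : ∀ l r z → twins (node l r) (⊎-map (size l ↑ʳ_) (size l ↑ʳ_) z) ≡ size (cherry l) ↑ʳ twins r z
twins-map-↑ʳ l r (inj₁ x) = twin-↑ʳ l r false x
twins-map-↑ʳ l r (inj₂ x) = twin-↑ʳ l r true x

twins-untwin : ∀ t y → twins t (untwin t y) ≡ y
twins-untwin leaf zero = refl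
twins-untwin leaf (suc zero) = refl
twins-untwin (node l r) = ↑-elim (size (cherry l)) (size (cherry r)) _ left right
  where
  left : ∀ u → twins (node l r) (untwin (node l r) (u ↑ˡ size (cherry r))) ≡ u ↑ˡ size (cherry r)
  left u rewrite splitAt-↑ˡ (size (cherry l)) u (size (cherry r)) =
    trans (twins-map-↑ˡ l r (untwin l u)) (cong (_↑ˡ size (cherry r)) (twins-untwin l u))
  right : ∀ v → twins (node l r) (untwin (node l r) (size (cherry l) ↑ʳ v)) ≡ size (cherry l) ↑ʳ v
  right v rewrite splitAt-↑ʳ (size (cherry l)) (size (cherry r)) v =
    trans (twins-map-↑ʳ l r (untwin r v)) (cong (size (cherry l) ↑ʳ_) (twins-untwin r v))

cherry-leaves : (t : Tree) → Fin (size (cherry t)) ↔ (Fin (size t) ⊎ Fin (size t))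
cherry-leaves t = mk↔ₛ′ (untwin t) (twins t) (untwin-twins t) (twins-untwin t)

-- A layout of cherry t amounts to a layout of t (its collapse) and an orientation of every cherry.

orientation : (t : Tree) → Layout (cherry t) → Fin (size t) → Bool
orientation leaf (nodeL o _ _) _ = o
orientation (node l r) (nodeL _ ρl ρr) x = [ orientation l ρl , orientation r ρr ]′ (splitAt (size l) x)

collapse : (t : Tree) → Layout (cherry t) → Layout t
collapse leaf _ = leafL
collapse (node l r) (nodeL b ρl ρr) = nodeL b (collapse l ρl) (collapse r ρr)

upright : (t : Tree) → Layout t → Layout (cherry t)
upright leaf leafL = nodeL true leafL leafL
upright (node l r) (nodeL b ρl ρr) = nodeL b (upright l ρl) (upright r ρr)

collapse-upright : ∀ t ρ → collapse t (upright t ρ) ≡ ρ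
collapse-upright leaf leafL = refl
collapse-upright (node l r) (nodeL b ρl ρr) =
  cong₂ (nodeL b) (collapse-upright l ρl) (collapse-upright r ρr)

orientation-upright : ∀ t ρ x → orientation t (upright t ρ) x ≡ true
orientation-upright leaf leafL x = refl
orientation-upright (node l r) (nodeL b ρl ρr) = ↑-elim (size l) (size r) _
  (λ u → trans (cong [ orientation l (upright l ρl) , orientation r (upright r ρr) ]′
                     (splitAt-↑ˡ (size l) u (size r)))
               (orientation-upright l ρl u))
  (λ v → trans (cong [ orientation l (upright l ρl) , orientation r (upright r ρr) ]′
                     (splitAt-↑ʳ (size l) (size r) v))
               (orientation-upright r ρr v))

twinPair : {A : Set} (t : Tree) → (Fin (size (cherry t)) → A) → Layout (cherry t) → Fin (size t) → List A
twinPair t g ρ x = orient (orientation t ρ x) (g (twin t false x)) (g (twin t true x))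

twinPair-↑ˡ : ∀ {A : Set} l r (g : Fin (size (cherry (node l r))) → A) b ρl ρr u →
  twinPair (node l r) g (nodeL b ρl ρr) (u ↑ˡ size r) ≡ twinPair l (g ∘ (_↑ˡ size (cherry r))) ρl u
twinPair-↑ˡ l r g b ρl ρr u rewrite splitAt-↑ˡ (size l) u (size r) = refl

twinPair-↑ʳ : ∀ {A : Set} l r (g : Fin (size (cherry (node l r))) → A) b ρl ρr v →
  twinPair (node l r) g (nodeL b ρl ρr) (size l ↑ʳ v) ≡ twinPair r (g ∘ (size (cherry l) ↑ʳ_)) ρr v
twinPair-↑ʳ l r g b ρl ρr v rewrite splitAt-↑ʳ (size l) (size r) v = refl

map-reindex-concatMap : ∀ {A B C D E : Set} {g : B → C} (f : A → B) xs
  {h : D → List C} {P : E → List C} (k : D → E) ys →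
  map (g ∘ f) xs ≡ concatMap h ys → (∀ y → h y ≡ P (k y)) → map g (map f xs) ≡ concatMap P (map k ys)
map-reindex-concatMap {g = g} f xs {h} {P} k ys eq h≗P∘k = begin
  map g (map f xs)      ≡⟨ sym (map-∘ xs) ⟩
  map (g ∘ f) xs        ≡⟨ eq ⟩
  concatMap h ys        ≡⟨ concatMap-cong h≗P∘k ys ⟩
  concatMap (P ∘ k) ys  ≡⟨ sym (concatMap-map P k ys) ⟩
  concatMap P (map k ys) ∎
  where open ≡-Reasoning

map-++-concatMap : ∀ {A B C : Set} {g : A → C} {P : B → List C} xs ys xs′ ys′ →
  map g xs ≡ concatMap P xs′ → map g ys ≡ concatMap P ys′ → map g (xs ++ ys) ≡ concatMap P (xs′ ++ ys′)
map-++-concatMap {g = g} {P} xs ys xs′ ys′ eqx eqy = begin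
  map g (xs ++ ys)                          ≡⟨ map-++ g xs ys ⟩
  map g xs ++ map g ys                      ≡⟨ cong₂ _++_ eqx eqy ⟩
  concat (map P xs′) ++ concat (map P ys′)  ≡⟨ concat-++ (map P xs′) (map P ys′) ⟩
  concat (map P xs′ ++ map P ys′)           ≡⟨ cong concat (sym (map-++ P xs′ ys′)) ⟩
  concatMap P (xs′ ++ ys′)                  ∎
  where open ≡-Reasoning

map-if-++-concatMap : ∀ {A B C : Set} {g : A → C} {P : B → List C} b xs ys xs′ ys′ →
  map g xs ≡ concatMap P xs′ → map g ys ≡ concatMap P ys′ →
  map g (if b then xs ++ ys else ys ++ xs) ≡ concatMap P (if b then xs′ ++ ys′ else ys′ ++ xs′)
map-if-++-concatMap true xs ys xs′ ys′ eqx eqy = map-++-concatMap xs ys xs′ ys′ eqx eqy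
map-if-++-concatMap false xs ys xs′ ys′ eqx eqy = map-++-concatMap ys xs ys′ xs′ eqy eqx

map-order-cherry : ∀ {A : Set} t (g : Fin (size (cherry t)) → A) ρ →
  map g (order (cherry t) ρ) ≡ concatMap (twinPair t g ρ) (order t (collapse t ρ))
map-order-cherry leaf g (nodeL true leafL leafL) = refl
map-order-cherry leaf g (nodeL false leafL leafL) = refl
map-order-cherry (node l r) g (nodeL b ρl ρr) =
  map-if-++-concatMap b (map (_↑ˡ size (cherry r)) (order (cherry l) ρl))
                        (map (size (cherry l) ↑ʳ_) (order (cherry r) ρr))
                        (map (_↑ˡ size r) (order l (collapse l ρl)))
                        (map (size l ↑ʳ_) (order r (collapse r ρr)))
    (map-reindex-concatMap (_↑ˡ size (cherry r)) (order (cherry l) ρl)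
                           (_↑ˡ size r) (order l (collapse l ρl))
                           (map-order-cherry l (g ∘ (_↑ˡ size (cherry r))) ρl)
                           (λ u → sym (twinPair-↑ˡ l r g b ρl ρr u)))
    (map-reindex-concatMap (size (cherry l) ↑ʳ_) (order (cherry r) ρr)
                           (size l ↑ʳ_) (order r (collapse r ρr))
                           (map-order-cherry r (g ∘ (size (cherry l) ↑ʳ_)) ρr)
                           (λ v → sym (twinPair-↑ʳ l r g b ρl ρr v)))

module Doubling (t s : Tree) (σ : Fin (size t) ↔ Fin (size s)) where

  n : ℕ
  n = size s

  σ→ : Fin (size t) → Fin n
  σ→ = Inverse.to σ

  doubled-matching : Fin (size (cherry t)) ↔ Fin (n + n)
  doubled-matching = ↔-trans (cherry-leaves t) (↔-trans (σ ⊎-↔ σ) (↔-sym +↔⊎))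

  original doubled : Tanglegram
  original = tanglegram t s σ
  doubled = tanglegram (cherry t) (node s s) doubled-matching

  topHalf bottomHalf : Layout (node s s) → Layout s
  topHalf (nodeL true ρ₀ ρ₁) = ρ₀
  topHalf (nodeL false ρ₀ ρ₁) = ρ₁
  bottomHalf (nodeL true ρ₀ ρ₁) = ρ₁
  bottomHalf (nodeL false ρ₀ ρ₁) = ρ₀

  matchedPosition : Layout (node s s) → Fin (size (cherry t)) → ℕ
  matchedPosition ρ y = position (order (node s s) ρ) (Inverse.to doubled-matching y)

  matchedPosition-twin : ∀ ρ c x →
    matchedPosition ρ (twin t c x) ≡ position (order (node s s) ρ) (join n n (select c (σ→ x)))
  matchedPosition-twin ρ c x = cong (position (order (node s s) ρ) ∘ join n n)
    (trans (cong (Inverse.to (σ ⊎-↔ σ)) (untwin-twin t c x)) (map-select σ→ c x))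

  twinPair-arrangement : ∀ ℓ ρ x →
    Arrangement (position (order s (topHalf ρ)) (σ→ x)) (n + position (order s (bottomHalf ρ)) (σ→ x))
                (twinPair t (matchedPosition ρ) ℓ x)
  twinPair-arrangement ℓ ρ@(nodeL true ρ₀ ρ₁) x = orient-arrangement (orientation t ℓ x)
    (trans (matchedPosition-twin ρ false x) (position-order-↑ˡ s s true ρ₀ ρ₁ (σ→ x)))
    (trans (matchedPosition-twin ρ true x) (position-order-↑ʳ s s true ρ₀ ρ₁ (σ→ x)))
  twinPair-arrangement ℓ ρ@(nodeL false ρ₀ ρ₁) x = orient-arrangement-swapped (orientation t ℓ x)
    (trans (matchedPosition-twin ρ false x) (position-order-↑ˡ s s false ρ₀ ρ₁ (σ→ x)))
    (trans (matchedPosition-twin ρ true x) (position-order-↑ʳ s s false ρ₀ ρ₁ (σ→ x)))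

  turnedCherries : Layout (cherry t) → Layout (node s s) → ℕ
  turnedCherries ℓ ρ = sum (map (inversions ∘ twinPair t (matchedPosition ρ) ℓ) (order t (collapse t ℓ)))

  crossings-doubled : ∀ ℓ ρ → crossings doubled ℓ ρ ≡
    crossings original (collapse t ℓ) (topHalf ρ) + crossings original (collapse t ℓ) (bottomHalf ρ) +
    triangle (size t) + turnedCherries ℓ ρ
  crossings-doubled ℓ ρ = begin
    inversions (map (matchedPosition ρ) (order (cherry t) ℓ))
      ≡⟨ cong inversions (map-order-cherry t (matchedPosition ρ) ℓ) ⟩
    inversions (concatMap (twinPair t (matchedPosition ρ) ℓ) xs)
      ≡⟨ inversions-concatMap-blocks _ _ _ n
           (λ x → position<size s (topHalf ρ) (σ→ x)) (twinPair-arrangement ℓ ρ) xs ⟩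
    crossings original τ (topHalf ρ) + crossings original τ (bottomHalf ρ) +
      triangle (length xs) + turnedCherries ℓ ρ
      ≡⟨ cong (λ m → crossings original τ (topHalf ρ) + crossings original τ (bottomHalf ρ) +
                     triangle m + turnedCherries ℓ ρ) (length-order t τ) ⟩
    crossings original τ (topHalf ρ) + crossings original τ (bottomHalf ρ) +
      triangle (size t) + turnedCherries ℓ ρ ∎
    where
    open ≡-Reasoning
    τ = collapse t ℓ
    xs = order t τ

  turnedCherries-upright : ∀ τ ρ → turnedCherries (upright t τ) (nodeL true ρ ρ) ≡ 0
  turnedCherries-upright τ ρ = sum-map-≡0 _ (order t (collapse t (upright t τ))) ascending
    where
    ascending : ∀ x → inversions (twinPair t (matchedPosition (nodeL true ρ ρ)) (upright t τ) x) ≡ 0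
    ascending x rewrite orientation-upright t τ x
                      | matchedPosition-twin (nodeL true ρ ρ) false x
                      | matchedPosition-twin (nodeL true ρ ρ) true x
                      | position-order-↑ˡ s s true ρ ρ (σ→ x)
                      | position-order-↑ʳ s s true ρ ρ (σ→ x) =
      inversions-ascending-pair (≤-trans (<⇒≤ (position<size s ρ (σ→ x))) (m≤m+n n _))

  isCrt-doubled : ∀ k → IsCrt original k → IsCrt doubled (k + k + triangle (size t))
  isCrt-doubled k ((τ , ρ , optimal) , minimal) =
    (upright t τ , nodeL true ρ ρ , achieved) , bounded
    where
    achieved : crossings doubled (upright t τ) (nodeL true ρ ρ) ≡ k + k + triangle (size t)
    achieved = begin
      crossings doubled (upright t τ) (nodeL true ρ ρ)
        ≡⟨ crossings-doubled (upright t τ) (nodeL true ρ ρ) ⟩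
      crossings original (collapse t (upright t τ)) ρ + crossings original (collapse t (upright t τ)) ρ +
        triangle (size t) + turnedCherries (upright t τ) (nodeL true ρ ρ)
        ≡⟨ cong₂ (λ μ m → crossings original μ ρ + crossings original μ ρ + triangle (size t) + m)
                 (collapse-upright t τ) (turnedCherries-upright τ ρ) ⟩
      crossings original τ ρ + crossings original τ ρ + triangle (size t) + 0
        ≡⟨ +-identityʳ _ ⟩
      crossings original τ ρ + crossings original τ ρ + triangle (size t)
        ≡⟨ cong (λ m → m + m + triangle (size t)) optimal ⟩
      k + k + triangle (size t) ∎
      where open ≡-Reasoning
    bounded : ∀ ℓ ρ′ → k + k + triangle (size t) ≤ crossings doubled ℓ ρ′
    bounded ℓ ρ′ = begin
      k + k + triangle (size t)
        ≤⟨ +-monoˡ-≤ (triangle (size t)) (+-mono-≤ (minimal _ (topHalf ρ′)) (minimal _ (bottomHalf ρ′))) ⟩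
      crossings original (collapse t ℓ) (topHalf ρ′) + crossings original (collapse t ℓ) (bottomHalf ρ′) +
        triangle (size t)
        ≤⟨ m≤m+n _ (turnedCherries ℓ ρ′) ⟩
      crossings original (collapse t ℓ) (topHalf ρ′) + crossings original (collapse t ℓ) (bottomHalf ρ′) +
        triangle (size t) + turnedCherries ℓ ρ′
        ≡⟨ sym (crossings-doubled ℓ ρ′) ⟩
      crossings doubled ℓ ρ′ ∎
      where open ≤-Reasoning

doubling : Tanglegram → Tanglegram
doubling T = Doubling.doubled (L T) (R T) (σ T)

tsize-doubling : ∀ T → tsize (doubling T) ≡ tsize T + tsize T
tsize-doubling T = size-cherry (L T)

isCrt-doubling : ∀ T k → IsCrt T k → IsCrt (doubling T) (k + k + triangle (tsize T))
isCrt-doubling T = Doubling.isCrt-doubled (L T) (R T) (σ T)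

iteratedDoubling : ℕ → Tanglegram
iteratedDoubling zero = tanglegram leaf leaf ↔-refl
iteratedDoubling (suc i) = doubling (iteratedDoubling i)

crtIterated : ℕ → ℕ
crtIterated zero = 0
crtIterated (suc i) = crtIterated i + crtIterated i + triangle (2 ^ i)

2^suc≡2^+2^ : ∀ i → 2 ^ suc i ≡ 2 ^ i + 2 ^ i
2^suc≡2^+2^ i = cong (2 ^ i +_) (+-identityʳ (2 ^ i))

tsize-iteratedDoubling : ∀ i → tsize (iteratedDoubling i) ≡ 2 ^ i
tsize-iteratedDoubling zero = refl
tsize-iteratedDoubling (suc i) =
  trans (tsize-doubling (iteratedDoubling i))
        (trans (cong (λ m → m + m) (tsize-iteratedDoubling i)) (sym (2^suc≡2^+2^ i)))

isCrt-iteratedDoubling : ∀ i → IsCrt (iteratedDoubling i) (crtIterated i)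
isCrt-iteratedDoubling zero = (leafL , leafL , refl) , (λ _ _ → z≤n)
isCrt-iteratedDoubling (suc i) =
  subst (λ m → IsCrt (iteratedDoubling (suc i)) (crtIterated i + crtIterated i + triangle m))
        (tsize-iteratedDoubling i)
        (isCrt-doubling (iteratedDoubling i) (crtIterated i) (isCrt-iteratedDoubling i))

triangle-double : ∀ m → triangle (m + m) ≡ 4 * triangle m + m
triangle-double zero = refl
triangle-double (suc m) rewrite +-suc m m | triangle-double m =
  solve 2 (λ m T → con 1 :+ ((m :+ m) :+ ((m :+ m) :+ (con 4 :* T :+ m)))
                := con 4 :* (m :+ T) :+ (con 1 :+ m)) refl
    m (triangle m)

crtIterated-closedForm : ∀ i → 4 * crtIterated i + i * 2 ^ i ≡ 2 * triangle (2 ^ i)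
crtIterated-closedForm zero = refl
crtIterated-closedForm (suc i) = begin
  4 * (K + K + T) + suc i * (2 * N)
    ≡⟨ solve 4 (λ K T i N → con 4 :* (K :+ K :+ T) :+ (con 1 :+ i) :* (con 2 :* N)
                 := con 2 :* (con 4 :* K :+ i :* N) :+ con 4 :* T :+ con 2 :* N) refl K T i N ⟩
  2 * (4 * K + i * N) + 4 * T + 2 * N
    ≡⟨ cong (λ m → 2 * m + 4 * T + 2 * N) (crtIterated-closedForm i) ⟩
  2 * (2 * T) + 4 * T + 2 * N
    ≡⟨ solve 2 (λ T N → con 2 :* (con 2 :* T) :+ con 4 :* T :+ con 2 :* N
                 := con 2 :* (con 4 :* T :+ N)) refl T N ⟩
  2 * (4 * T + N)
    ≡⟨ cong (2 *_) (sym (triangle-double N)) ⟩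
  2 * triangle (N + N)
    ≡⟨ cong (λ m → 2 * triangle m) (sym (2^suc≡2^+2^ i)) ⟩
  2 * triangle (2 * N) ∎
  where
  open ≡-Reasoning
  K = crtIterated i
  T = triangle (2 ^ i)
  N = 2 ^ i

theorem1 : (j : ℕ) → Σ Tanglegram λ T → Σ ℕ λ k →
    tsize T ≡ 2 ^ suc j × IsCrt T k × 4 * k + suc j * 2 ^ suc j ≡ 2 * ((2 ^ suc j) C 2)
theorem1 j =
  iteratedDoubling (suc j) , crtIterated (suc j) ,
  tsize-iteratedDoubling (suc j) , isCrt-iteratedDoubling (suc j) ,
  trans (crtIterated-closedForm (suc j)) (cong (2 *_) (triangle≡C2 (2 ^ suc j)))
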